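{- Let $n_1,\dots,n_k,m_1,\dots,m_k\ge 2$ be integers such that for each $i$, $n_i$ and $m_i$ have the same number of distinct prime factors and the same exponents, i.e. $n_i=p_{i,1}^{\alpha_{i,1}}\cdots p_{i,j_i}^{\alpha_{i,j_i}}$ and $m_i=q_{i,1}^{\alpha_{i,1}}\cdots q_{i,j_i}^{\alpha_{i,j_i}}$ with the $p_{i,l}$ distinct primes and the $q_{i,l}$ distinct primes. Then the type graphs $\Gamma^T(\mathbb{Z}_{n_1}\times\cdots\times\mathbb{Z}_{n_k})$ and $\Gamma^T(\mathbb{Z}_{m_1}\times\cdots\times\mathbb{Z}_{m_k})$ are isomorphic.
   Context: For integers $n_1,\dots,n_k\ge2$, the type graph $\Gamma^T(\mathbb{Z}_{n_1}\times\cdots\times\mathbb{Z}_{n_k})$ is the simple graph defined as follows. Its vertices are the type classes $T(x_1,\dots,x_k)$, where each $x_i$ is either $0$ or a positive divisor of $n_i$ with $x_i<n_i$ (so $x_i=1$ is allowed), and $(x_1,\dots,x_k)$ is neither $(0,\dots,0)$ nor $(1,\dots,1)$. Here $T(x_1,\dots,x_k)$ is the set of tuples $(a_1,\dots,a_k)\in\mathbb{Z}_{n_1}\times\cdots\times\mathbb{Z}_{n_k}$ such that $a_i=0$ if $x_i=0$, and $a_i\neq0$ with $\gcd(a_i,n_i)=x_i$ if $x_i\neq 0$. Two distinct vertices $T(x_1,\dots,x_k)$ and $T(y_1,\dots,y_k)$ are adjacent iff $x_iy_i\equiv 0\pmod{n_i}$ for all $i$. -}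

module Defs where

open import Data.Nat using (ℕ; zero; suc; _*_; _^_; _<_; _≤_)
open import Data.Nat.Divisibility using (_∣_)
open import Data.Nat.Primality using (Prime)
open import Data.Fin using (Fin; zero; suc)
open import Data.Vec using (Vec; lookup)
open import Data.Product using (Σ; ∃; _×_; proj₁)
open import Data.Sum using (_⊎_)
open import Relation.Binary.PropositionalEquality using (_≡_)
open import Relation.Nullary using (¬_)
open import Function.Definitions using (Injective)

prodFin : (j : ℕ) → (Fin j → ℕ) → ℕ
prodFin zero    f = 1
prodFin (suc j) f = f zero * prodFin j (λ l → f (suc l))

LabelOK : ℕ → ℕ → Set
LabelOK n x = (x ≡ 0) ⊎ (1 ≤ x × x ∣ n × x < n)

IsTypeVertex : {k : ℕ} → Vec ℕ k → Vec ℕ k → Set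
IsTypeVertex {k} n x =
  ((i : Fin k) → LabelOK (lookup n i) (lookup x i))
  × ¬ ((i : Fin k) → lookup x i ≡ 0)
  × ¬ ((i : Fin k) → lookup x i ≡ 1)

TypeVertex : {k : ℕ} → Vec ℕ k → Set
TypeVertex {k} n = Σ (Vec ℕ k) (IsTypeVertex n)

TypeAdj : {k : ℕ} → Vec ℕ k → Vec ℕ k → Vec ℕ k → Set
TypeAdj {k} n x y = ¬ (x ≡ y) × ((i : Fin k) → lookup n i ∣ lookup x i * lookup y i)

-- graph isomorphism between type graphs: mutually inverse vertex maps
-- (vertices identified by their label tuples) preserving and reflecting adjacency
record TypeGraphIso {k : ℕ} (n m : Vec ℕ k) : Set where
  field
    to      : TypeVertex n → TypeVertex m
    from    : TypeVertex m → TypeVertex n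
    from∘to : (v : TypeVertex n) → proj₁ (from (to v)) ≡ proj₁ v
    to∘from : (w : TypeVertex m) → proj₁ (to (from w)) ≡ proj₁ w
    adj⇔    : (u v : TypeVertex n) →
              (TypeAdj n (proj₁ u) (proj₁ v) → TypeAdj m (proj₁ (to u)) (proj₁ (to v)))
              × (TypeAdj m (proj₁ (to u)) (proj₁ (to v)) → TypeAdj n (proj₁ u) (proj₁ v))

SameExponentShape : ℕ → ℕ → Set
SameExponentShape n m =
  Σ ℕ λ j → Σ (Fin j → ℕ) λ p → Σ (Fin j → ℕ) λ q → Σ (Fin j → ℕ) λ a →
    ((l : Fin j) → Prime (p l)) × Injective _≡_ _≡_ p ×
    ((l : Fin j) → Prime (q l)) × Injective _≡_ _≡_ q ×
    ((l : Fin j) → 1 ≤ a l) ×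
    (n ≡ prodFin j (λ l → p l ^ a l)) × (m ≡ prodFin j (λ l → q l ^ a l))

-- Adjacency T(x) ~ T(y) only asks n_i ∣ x_i y_i coordinatewise, so the type graph of
-- Z_{n_1} × ⋯ × Z_{n_k} depends only on each divisor set of n_i together with the
-- relation "n ∣ d e". For n = ∏ p_l^{a_l} and m = ∏ q_l^{a_l} there is a bijection of
-- divisors preserving that relation, 1 and n: on a prime power it is p^i ↦ q^i (and
-- p^a ∣ p^i p^j iff a ≤ i + j), and it extends to coprime products by splitting a
-- divisor d of A C as gcd(d, A) · gcd(d, C). Applying these bijections coordinatewise,
-- with 0 ↦ 0, is the graph isomorphism.
module Submission where

open import Algebra.Properties.CommutativeSemigroup as CommSemigroupProperties using ()
open import Data.Nat
open import Data.Nat.Properties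
open import Data.Nat.Divisibility
open import Data.Nat.GCD
open import Data.Nat.Coprimality as Coprime using (Coprime; coprime-divisor)
open import Data.Nat.Primality using (Prime; prime⇒nonZero; prime⇒nonTrivial; prime⇒irreducible)
open import Data.Fin using (Fin; zero; suc)
import Data.Fin.Properties as Fin
open import Data.Vec using (Vec; lookup; tabulate)
open import Data.Vec.Properties using (lookup∘tabulate; tabulate∘lookup; tabulate-cong)
open import Data.Product using (Σ; _×_; _,_)
open import Data.Product.Function.NonDependent.Propositional using (_×-⇔_)
open import Data.Sum using (inj₁; inj₂; [_,_])
open import Function using (_∘_; id; _⇔_; mk⇔; Equivalence)
open import Function.Construct.Composition using (_⇔-∘_)
open import Function.Construct.Symmetry using (⇔-sym)
open import Function.Definitions using (Injective)
import Function.Related.Propositional as Related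
open import Relation.Nullary using (¬_; yes; no; contradiction)
open import Relation.Binary.PropositionalEquality
  using (_≡_; _≢_; refl; sym; trans; cong; cong₂; subst; module ≡-Reasoning)
open import Defs

open CommSemigroupProperties *-commutativeSemigroup using (interchange)

private
  variable
    a b c d e i m n o p q u u′ v v′ A B C D : ℕ

∣-≡⇔ : n ≡ o → m ∣ n ⇔ m ∣ o
∣-≡⇔ refl = mk⇔ id id

coprime-divisors : Coprime m n → d ∣ m → e ∣ n → Coprime d e
coprime-divisors c d∣m e∣n (i∣d , i∣e) = c (∣-trans i∣d d∣m , ∣-trans i∣e e∣n)

coprime-*ʳ : Coprime m n → Coprime m o → Coprime m (n * o)
coprime-*ʳ c₁ c₂ (i∣m , i∣no) = c₂ (i∣m , coprime-divisor (coprime-divisors c₁ i∣m ∣-refl) i∣no)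

coprime-^ʳ : ∀ a → Coprime m n → Coprime m (n ^ a)
coprime-^ʳ zero    _ (_ , i∣1) = ∣1⇒≡1 i∣1
coprime-^ʳ (suc a) c = coprime-*ʳ c (coprime-^ʳ a c)

coprime-^ˡ : ∀ a → Coprime m n → Coprime (m ^ a) n
coprime-^ˡ a = Coprime.sym ∘ coprime-^ʳ a ∘ Coprime.sym

coprime-*-∣ : Coprime m n → m ∣ o → n ∣ o → m * n ∣ o
coprime-*-∣ {m} {n} c (divides k refl) n∣km =
  subst (m * n ∣_) (*-comm m k)
    (*-monoʳ-∣ m (coprime-divisor (Coprime.sym c) (subst (n ∣_) (*-comm k m) n∣km)))

∣*⇒∣gcd*gcd : d ∣ m * n → d ∣ gcd d m * gcd d n
∣*⇒∣gcd*gcd {d} {m} {n} d∣mn = ∣-trans (gcd-greatest (n∣m*n g) d∣g*n)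
                                        (∣-reflexive (sym (c*gcd[m,n]≡gcd[cm,cn] g d n)))
  where
  g = gcd d m
  d∣n*g : d ∣ n * g
  d∣n*g = ∣-trans (gcd-greatest (n∣m*n n) (subst (d ∣_) (*-comm m n) d∣mn))
                  (∣-reflexive (sym (c*gcd[m,n]≡gcd[cm,cn] n d m)))
  d∣g*n : d ∣ g * n
  d∣g*n = subst (d ∣_) (*-comm n g) d∣n*g

coprime⇒≡gcd*gcd : Coprime m n → d ∣ m * n → d ≡ gcd d m * gcd d n
coprime⇒≡gcd*gcd {m} {n} {d} c d∣mn = ∣-antisym (∣*⇒∣gcd*gcd d∣mn)
  (coprime-*-∣ (coprime-divisors c (gcd[m,n]∣n d m) (gcd[m,n]∣n d n))
               (gcd[m,n]∣m d m) (gcd[m,n]∣m d n))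

coprime⇒gcd[d*e,m]≡d : Coprime m n → d ∣ m → e ∣ n → gcd (d * e) m ≡ d
coprime⇒gcd[d*e,m]≡d {m} {n} {d} {e} c d∣m e∣n = ∣-antisym
  (coprime-divisor (coprime-divisors c (gcd[m,n]∣n (d * e) m) e∣n)
                   (subst (gcd (d * e) m ∣_) (*-comm d e) (gcd[m,n]∣m (d * e) m)))
  (gcd-greatest (m∣m*n e) d∣m)

coprime⇒gcd[d*e,n]≡e : Coprime m n → d ∣ m → e ∣ n → gcd (d * e) n ≡ e
coprime⇒gcd[d*e,n]≡e {m} {n} {d} {e} c d∣m e∣n =
  trans (cong (λ x → gcd x n) (*-comm d e)) (coprime⇒gcd[d*e,m]≡d (Coprime.sym c) e∣n d∣m)

coprime⇒*∣*⇔∣×∣ : Coprime m n → u ∣ m → u′ ∣ m → v ∣ n → v′ ∣ n →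
                   m * n ∣ (u * v) * (u′ * v′) ⇔ (m ∣ u * u′ × n ∣ v * v′)
coprime⇒*∣*⇔∣×∣ {m} {n} {u} {u′} {v} {v′} c u∣m u′∣m v∣n v′∣n =
  mk⇔ split (subst (m * n ∣_) (sym (interchange u v u′ v′)) ∘ join)
  where
  join : m ∣ u * u′ × n ∣ v * v′ → m * n ∣ (u * u′) * (v * v′)
  join (m∣uu′ , n∣vv′) = *-pres-∣ m∣uu′ n∣vv′
  split : m * n ∣ (u * v) * (u′ * v′) → m ∣ u * u′ × n ∣ v * v′
  split h = coprime-divisor m⊥vv′ (subst (m ∣_) (*-comm (u * u′) (v * v′)) (m*n∣⇒m∣ m n h′))
          , coprime-divisor n⊥uu′ (m*n∣⇒n∣ m n h′)
    where
    h′ = subst (m * n ∣_) (interchange u v u′ v′) h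
    m⊥vv′ = coprime-*ʳ (coprime-divisors c ∣-refl v∣n) (coprime-divisors c ∣-refl v′∣n)
    c′ = Coprime.sym c
    n⊥uu′ = coprime-*ʳ (coprime-divisors c′ ∣-refl u∣m) (coprime-divisors c′ ∣-refl u′∣m)

prime>1 : Prime p → 1 < p
prime>1 {p} pp = nonTrivial⇒n>1 p {{prime⇒nonTrivial pp}}

prime∤⇒coprime : Prime p → ¬ p ∣ n → Coprime p n
prime∤⇒coprime pp p∤n (i∣p , i∣n) with prime⇒irreducible pp i∣p
... | inj₁ i≡1 = i≡1
... | inj₂ refl = contradiction i∣n p∤n

distinctPrimes⇒coprime : Prime p → Prime q → p ≢ q → Coprime p q
distinctPrimes⇒coprime pp pq p≢q = prime∤⇒coprime pp λ p∣q →
  [ nonTrivial⇒≢1 {{prime⇒nonTrivial pp}} , p≢q ] (prime⇒irreducible pq p∣q)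

∣p^a⇒≡p^i : Prime p → ∀ a → d ∣ p ^ a → Σ ℕ λ i → i ≤ a × d ≡ p ^ i
∣p^a⇒≡p^i _ zero d∣1 = 0 , z≤n , ∣1⇒≡1 d∣1
∣p^a⇒≡p^i {p} {d} pp (suc a) d∣p^1+a with p ∣? d
... | no p∤d =
  let i , i≤a , d≡p^i = ∣p^a⇒≡p^i pp a
                          (coprime-divisor (Coprime.sym (prime∤⇒coprime pp p∤d)) d∣p^1+a)
  in i , m≤n⇒m≤1+n i≤a , d≡p^i
... | yes (divides k refl) =
  let i , i≤a , k≡p^i = ∣p^a⇒≡p^i {d = k} pp a (*-cancelʳ-∣ p {{prime⇒nonZero pp}}
                          (subst (k * p ∣_) (*-comm p (p ^ a)) d∣p^1+a))
  in suc i , s≤s i≤a , trans (cong (_* p) k≡p^i) (*-comm (p ^ i) p)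

^-monoʳ-∣ : ∀ p → a ≤ b → p ^ a ∣ p ^ b
^-monoʳ-∣ {a} {b} p a≤b =
  subst (p ^ a ∣_) (trans (sym (^-distribˡ-+-* p a (b ∸ a))) (cong (p ^_) (m+[n∸m]≡n a≤b)))
        (m∣m*n (p ^ (b ∸ a)))

^-∣⇒≤ : 1 < p → p ^ a ∣ p ^ b → a ≤ b
^-∣⇒≤ {p} {a} {b} 1<p p^a∣p^b with a ≤? b
... | yes a≤b = a≤b
... | no a≰b = contradiction (∣⇒≤ {{m^n≢0 p b {{≢-nonZero (m<n⇒n≢0 1<p)}}}} p^a∣p^b)
                             (<⇒≱ (^-monoʳ-< p 1<p (≰⇒> a≰b)))

^-∣-^⇔≤ : 1 < p → p ^ a ∣ p ^ b ⇔ a ≤ b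
^-∣-^⇔≤ {p} 1<p = mk⇔ (^-∣⇒≤ 1<p) (^-monoʳ-∣ p)

^-injective : 1 < p → p ^ a ≡ p ^ b → a ≡ b
^-injective 1<p p^a≡p^b =
  ≤-antisym (^-∣⇒≤ 1<p (∣-reflexive p^a≡p^b)) (^-∣⇒≤ 1<p (∣-reflexive (sym p^a≡p^b)))

-- The largest i ≤ a with p ^ i ≡ d; junk value 0 if there is none.
discreteLog : ℕ → ℕ → ℕ → ℕ
discreteLog p zero    d = 0
discreteLog p (suc a) d with p ^ suc a ≟ d
... | yes _ = suc a
... | no  _ = discreteLog p a d

discreteLog-^ : 1 < p → i ≤ a → discreteLog p a (p ^ i) ≡ i
discreteLog-^ {i = zero} {a = zero} _ _ = refl
discreteLog-^ {p} {i} {suc a} 1<p i≤1+a with p ^ suc a ≟ p ^ i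
... | yes p^1+a≡p^i = ^-injective 1<p p^1+a≡p^i
... | no p^1+a≢p^i with m≤n⇒m<n∨m≡n i≤1+a
...   | inj₁ (s≤s i≤a) = discreteLog-^ 1<p i≤a
...   | inj₂ refl = contradiction refl p^1+a≢p^i

module _ (p q a : ℕ) where

  powerRelabel : ℕ → ℕ
  powerRelabel d = q ^ discreteLog p a d

  powerRelabel-^ : 1 < p → i ≤ a → powerRelabel (p ^ i) ≡ q ^ i
  powerRelabel-^ 1<p i≤a = cong (q ^_) (discreteLog-^ 1<p i≤a)

  powerRelabel-∣ : Prime p → d ∣ p ^ a → powerRelabel d ∣ q ^ a
  powerRelabel-∣ pp d∣p^a with ∣p^a⇒≡p^i pp a d∣p^a
  ... | i , i≤a , refl = subst (_∣ q ^ a) (sym (powerRelabel-^ (prime>1 pp) i≤a)) (^-monoʳ-∣ q i≤a)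

  powerRelabel-∣*⇔ : Prime p → 1 < q → d ∣ p ^ a → e ∣ p ^ a →
                     p ^ a ∣ d * e ⇔ q ^ a ∣ powerRelabel d * powerRelabel e
  powerRelabel-∣*⇔ pp 1<q d∣p^a e∣p^a with ∣p^a⇒≡p^i pp a d∣p^a | ∣p^a⇒≡p^i pp a e∣p^a
  ... | i , i≤a , refl | j , j≤a , refl
    rewrite powerRelabel-^ (prime>1 pp) i≤a | powerRelabel-^ (prime>1 pp) j≤a
          | sym (^-distribˡ-+-* p i j) | sym (^-distribˡ-+-* q i j)
    = ⇔-sym (^-∣-^⇔≤ {a = a} {b = i + j} 1<q) ⇔-∘ ^-∣-^⇔≤ (prime>1 pp)

powerRelabel-inverse : Prime p → 1 < q → ∀ a → d ∣ p ^ a →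
                       powerRelabel q p a (powerRelabel p q a d) ≡ d
powerRelabel-inverse {p} {q} pp 1<q a d∣p^a with ∣p^a⇒≡p^i pp a d∣p^a
... | i , i≤a , refl = trans (cong (powerRelabel q p a) (powerRelabel-^ p q a (prime>1 pp) i≤a))
                             (powerRelabel-^ q p a 1<q i≤a)

record DivisorIso (n m : ℕ) : Set where
  field
    to from : ℕ → ℕ
    to-∣    : ∀ {d} → d ∣ n → to d ∣ m
    from-∣  : ∀ {e} → e ∣ m → from e ∣ n
    from∘to : ∀ {d} → d ∣ n → from (to d) ≡ d
    to∘from : ∀ {e} → e ∣ m → to (from e) ≡ e
    ∣*⇔     : ∀ {d e} → d ∣ n → e ∣ n → n ∣ d * e ⇔ m ∣ to d * to e
    to-1    : to 1 ≡ 1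
    to-n    : to n ≡ m

  from-1 : from 1 ≡ 1
  from-1 = trans (cong from (sym to-1)) (from∘to (1∣ n))

  from-m : from m ≡ n
  from-m = trans (cong from (sym to-n)) (from∘to ∣-refl)

  from-∣*⇔ : ∀ {d e} → d ∣ m → e ∣ m → m ∣ d * e ⇔ n ∣ from d * from e
  from-∣*⇔ d∣m e∣m =
    ⇔-sym (∣-≡⇔ (cong₂ _*_ (to∘from d∣m) (to∘from e∣m)) ⇔-∘ ∣*⇔ (from-∣ d∣m) (from-∣ e∣m))

  to≢0 : m ≢ 0 → ∀ {d} → d ∣ n → to d ≢ 0
  to≢0 m≢0 d∣n to-d≡0 = m≢0 (0∣⇒≡0 (subst (_∣ m) to-d≡0 (to-∣ d∣n)))

open DivisorIso

DivisorIso-refl : DivisorIso n n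
DivisorIso-refl = record
  { to = id ; from = id ; to-∣ = id ; from-∣ = id ; from∘to = λ _ → refl ; to∘from = λ _ → refl
  ; ∣*⇔ = λ _ _ → mk⇔ id id ; to-1 = refl ; to-n = refl }

DivisorIso-sym : DivisorIso n m → DivisorIso m n
DivisorIso-sym D = record
  { to = from D ; from = to D ; to-∣ = from-∣ D ; from-∣ = to-∣ D
  ; from∘to = to∘from D ; to∘from = from∘to D ; ∣*⇔ = from-∣*⇔ D
  ; to-1 = from-1 D ; to-n = from-m D }

DivisorIso-^ : Prime p → Prime q → ∀ a → DivisorIso (p ^ a) (q ^ a)
DivisorIso-^ {p} {q} pp pq a = record
  { to = powerRelabel p q a ; from = powerRelabel q p a
  ; to-∣ = powerRelabel-∣ p q a pp ; from-∣ = powerRelabel-∣ q p a pq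
  ; from∘to = powerRelabel-inverse pp (prime>1 pq) a
  ; to∘from = powerRelabel-inverse pq (prime>1 pp) a
  ; ∣*⇔ = powerRelabel-∣*⇔ p q a pp (prime>1 pq)
  ; to-1 = powerRelabel-^ p q a (prime>1 pp) z≤n ; to-n = powerRelabel-^ p q a (prime>1 pp) ≤-refl }

splitMap : DivisorIso A B → DivisorIso C D → ℕ → ℕ
splitMap {A} {C = C} I J d = to I (gcd d A) * to J (gcd d C)

splitMap-∣ : (I : DivisorIso A B) (J : DivisorIso C D) → d ∣ A * C → splitMap I J d ∣ B * D
splitMap-∣ {A} {C = C} {d = d} I J _ = *-pres-∣ (to-∣ I (gcd[m,n]∣n d A)) (to-∣ J (gcd[m,n]∣n d C))

splitMap-inverse : Coprime A C → Coprime B D → (I : DivisorIso A B) (J : DivisorIso C D) →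
                   d ∣ A * C → splitMap (DivisorIso-sym I) (DivisorIso-sym J) (splitMap I J d) ≡ d
splitMap-inverse {A} {C} {B} {D} {d} cAC cBD I J d∣AC = begin
  from I (gcd (to I dA * to J dC) B) * from J (gcd (to I dA * to J dC) D)
    ≡⟨ cong₂ _*_ (cong (from I) (coprime⇒gcd[d*e,m]≡d cBD (to-∣ I dA∣) (to-∣ J dC∣)))
                 (cong (from J) (coprime⇒gcd[d*e,n]≡e cBD (to-∣ I dA∣) (to-∣ J dC∣))) ⟩
  from I (to I dA) * from J (to J dC)
    ≡⟨ cong₂ _*_ (from∘to I dA∣) (from∘to J dC∣) ⟩
  dA * dC
    ≡⟨ coprime⇒≡gcd*gcd cAC d∣AC ⟨
  d ∎
  where
  open ≡-Reasoning
  dA = gcd d A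
  dC = gcd d C
  dA∣ = gcd[m,n]∣n d A
  dC∣ = gcd[m,n]∣n d C

splitMap-∣*⇔ : Coprime A C → Coprime B D → (I : DivisorIso A B) (J : DivisorIso C D) →
               d ∣ A * C → e ∣ A * C → A * C ∣ d * e ⇔ B * D ∣ splitMap I J d * splitMap I J e
splitMap-∣*⇔ {A} {C} {B} {D} {d} {e} cAC cBD I J d∣AC e∣AC = begin
  A * C ∣ d * e
    ∼⟨ ∣-≡⇔ (cong₂ _*_ (coprime⇒≡gcd*gcd cAC d∣AC) (coprime⇒≡gcd*gcd cAC e∣AC)) ⟩
  A * C ∣ (dA * dC) * (eA * eC)
    ∼⟨ coprime⇒*∣*⇔∣×∣ cAC dA∣ eA∣ dC∣ eC∣ ⟩
  (A ∣ dA * eA × C ∣ dC * eC)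
    ∼⟨ ∣*⇔ I dA∣ eA∣ ×-⇔ ∣*⇔ J dC∣ eC∣ ⟩
  (B ∣ to I dA * to I eA × D ∣ to J dC * to J eC)
    ∼⟨ ⇔-sym (coprime⇒*∣*⇔∣×∣ cBD (to-∣ I dA∣) (to-∣ I eA∣) (to-∣ J dC∣) (to-∣ J eC∣)) ⟩
  B * D ∣ splitMap I J d * splitMap I J e ∎
  where
  open Related.EquationalReasoning
  dA = gcd d A
  dC = gcd d C
  eA = gcd e A
  eC = gcd e C
  dA∣ = gcd[m,n]∣n d A
  dC∣ = gcd[m,n]∣n d C
  eA∣ = gcd[m,n]∣n e A
  eC∣ = gcd[m,n]∣n e C

DivisorIso-* : Coprime A C → Coprime B D → DivisorIso A B → DivisorIso C D →
               DivisorIso (A * C) (B * D)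
DivisorIso-* {A} {C} cAC cBD I J = record
  { to = splitMap I J ; from = splitMap (DivisorIso-sym I) (DivisorIso-sym J)
  ; to-∣ = splitMap-∣ I J ; from-∣ = splitMap-∣ (DivisorIso-sym I) (DivisorIso-sym J)
  ; from∘to = splitMap-inverse cAC cBD I J
  ; to∘from = splitMap-inverse cBD cAC (DivisorIso-sym I) (DivisorIso-sym J)
  ; ∣*⇔ = splitMap-∣*⇔ cAC cBD I J
  ; to-1 = cong₂ _*_ (trans (cong (to I) (gcd-zeroˡ A)) (to-1 I))
                    (trans (cong (to J) (gcd-zeroˡ C)) (to-1 J))
  ; to-n = cong₂ _*_ (trans (cong (to I) (coprime⇒gcd[d*e,m]≡d cAC ∣-refl ∣-refl)) (to-n I))
                    (trans (cong (to J) (coprime⇒gcd[d*e,n]≡e cAC ∣-refl ∣-refl)) (to-n J)) }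

coprime-prodFin : ∀ {m} j (p a : Fin j → ℕ) → (∀ l → Coprime m (p l)) →
                  Coprime m (prodFin j (λ l → p l ^ a l))
coprime-prodFin zero    p a _ (_ , i∣1) = ∣1⇒≡1 i∣1
coprime-prodFin (suc j) p a c =
  coprime-*ʳ (coprime-^ʳ (a zero) (c zero)) (coprime-prodFin j (p ∘ suc) (a ∘ suc) (c ∘ suc))

distinctPrimes⇒coprime-head-tail : ∀ j (p a : Fin (suc j) → ℕ) →
  (∀ l → Prime (p l)) → Injective _≡_ _≡_ p →
  Coprime (p zero ^ a zero) (prodFin j (λ l → p (suc l) ^ a (suc l)))
distinctPrimes⇒coprime-head-tail j p a pp p-inj = coprime-^ˡ (a zero)
  (coprime-prodFin j (p ∘ suc) (a ∘ suc)
    (λ l → distinctPrimes⇒coprime (pp zero) (pp (suc l)) (Fin.0≢1+n ∘ p-inj)))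

distinctPrimePowers⇒DivisorIso : ∀ j (p q a : Fin j → ℕ) →
  (∀ l → Prime (p l)) → Injective _≡_ _≡_ p → (∀ l → Prime (q l)) → Injective _≡_ _≡_ q →
  DivisorIso (prodFin j (λ l → p l ^ a l)) (prodFin j (λ l → q l ^ a l))
distinctPrimePowers⇒DivisorIso zero    p q a _ _ _ _ = DivisorIso-refl
distinctPrimePowers⇒DivisorIso (suc j) p q a pp p-inj pq q-inj =
  DivisorIso-* (distinctPrimes⇒coprime-head-tail j p a pp p-inj)
               (distinctPrimes⇒coprime-head-tail j q a pq q-inj)
               (DivisorIso-^ (pp zero) (pq zero) (a zero))
               (distinctPrimePowers⇒DivisorIso j (p ∘ suc) (q ∘ suc) (a ∘ suc)
                  (pp ∘ suc) (Fin.suc-injective ∘ p-inj) (pq ∘ suc) (Fin.suc-injective ∘ q-inj))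

sameExponentShape⇒DivisorIso : SameExponentShape n m → DivisorIso n m
sameExponentShape⇒DivisorIso (j , p , q , a , pp , p-inj , pq , q-inj , _ , refl , refl) =
  distinctPrimePowers⇒DivisorIso j p q a pp p-inj pq q-inj

labelMap : (ℕ → ℕ) → ℕ → ℕ
labelMap h zero      = zero
labelMap h d@(suc _) = h d

labelMap-≢0 : ∀ (h : ℕ → ℕ) → d ≢ 0 → labelMap h d ≡ h d
labelMap-≢0 {zero}  _ d≢0 = contradiction refl d≢0
labelMap-≢0 {suc _} _ _   = refl

module _ (I : DivisorIso n m) (m≢0 : m ≢ 0) where

  labelMap-LabelOK : LabelOK n d → LabelOK m (labelMap (to I) d)
  labelMap-LabelOK {zero}  _ = inj₁ refl
  labelMap-LabelOK {suc _} (inj₂ (_ , d∣n , d<n)) =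
    inj₂ (n≢0⇒n>0 (to≢0 I m≢0 d∣n) , to-∣ I d∣n ,
          ≤∧≢⇒< (∣⇒≤ {{≢-nonZero m≢0}} (to-∣ I d∣n)) Id≢m)
    where
    Id≢m : to I _ ≢ m
    Id≢m Id≡m = <⇒≢ d<n (trans (sym (from∘to I d∣n)) (trans (cong (from I) Id≡m) (from-m I)))

  labelMap-inverse : LabelOK n d → labelMap (from I) (labelMap (to I) d) ≡ d
  labelMap-inverse {zero}  _ = refl
  labelMap-inverse {suc _} (inj₂ (_ , d∣n , _)) =
    trans (labelMap-≢0 (from I) (to≢0 I m≢0 d∣n)) (from∘to I d∣n)

  labelMap-reflects : LabelOK n d → labelMap (to I) d ≡ c → labelMap (from I) c ≡ c → d ≡ c
  labelMap-reflects ok Id≡c fixed =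
    trans (sym (labelMap-inverse ok)) (trans (cong (labelMap (from I)) Id≡c) fixed)

  labelMap-∣*⇔ : LabelOK n d → LabelOK n e → n ∣ d * e ⇔ m ∣ labelMap (to I) d * labelMap (to I) e
  labelMap-∣*⇔ {zero}          _ _ = mk⇔ (λ _ → m ∣0) (λ _ → n ∣0)
  labelMap-∣*⇔ {d@(suc _)} {zero} _ _ =
    mk⇔ (λ _ → divides 0 (*-zeroʳ (to I d))) (λ _ → divides 0 (*-zeroʳ d))
  labelMap-∣*⇔ {suc _} {suc _} (inj₂ (_ , d∣n , _)) (inj₂ (_ , e∣n , _)) = ∣*⇔ I d∣n e∣n

Labels : {k : ℕ} → Vec ℕ k → Vec ℕ k → Set
Labels {k} n x = (i : Fin k) → LabelOK (lookup n i) (lookup x i)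

relabel : {k : ℕ} → (Fin k → ℕ → ℕ) → Vec ℕ k → Vec ℕ k
relabel h x = tabulate λ i → labelMap (h i) (lookup x i)

lookup-relabel : {k : ℕ} (h : Fin k → ℕ → ℕ) (x : Vec ℕ k) (i : Fin k) →
                 lookup (relabel h x) i ≡ labelMap (h i) (lookup x i)
lookup-relabel h x = lookup∘tabulate (λ i → labelMap (h i) (lookup x i))

module Relabelling {k : ℕ} {n m : Vec ℕ k}
         (I : (i : Fin k) → DivisorIso (lookup n i) (lookup m i))
         (m≢0 : (i : Fin k) → lookup m i ≢ 0) where

  relabel-Labels : ∀ x → Labels n x → Labels m (relabel (to ∘ I) x)
  relabel-Labels x ok i =
    subst (LabelOK _) (sym (lookup-relabel (to ∘ I) x i)) (labelMap-LabelOK (I i) (m≢0 i) (ok i))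

  relabel-inverse : ∀ x → Labels n x → relabel (from ∘ I) (relabel (to ∘ I) x) ≡ x
  relabel-inverse x ok = trans
    (tabulate-cong λ i → trans (cong (labelMap (from (I i))) (lookup-relabel (to ∘ I) x i))
                               (labelMap-inverse (I i) (m≢0 i) (ok i)))
    (tabulate∘lookup x)

  relabel-reflects-constant : ∀ x → Labels n x → (∀ i → labelMap (from (I i)) c ≡ c) →
                              (∀ i → lookup (relabel (to ∘ I) x) i ≡ c) → ∀ i → lookup x i ≡ c
  relabel-reflects-constant x ok fixed const i =
    labelMap-reflects (I i) (m≢0 i) (ok i)
      (trans (sym (lookup-relabel (to ∘ I) x i)) (const i)) (fixed i)

  relabelVertex : TypeVertex n → TypeVertex m
  relabelVertex (x , ok , ¬all0 , ¬all1) =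
    relabel (to ∘ I) x , relabel-Labels x ok ,
    (λ all0 → ¬all0 (relabel-reflects-constant x ok (λ _ → refl) all0)) ,
    (λ all1 → ¬all1 (relabel-reflects-constant x ok (from-1 ∘ I) all1))

  relabel-TypeAdj⇔ : {x y : Vec ℕ k} → Labels n x → Labels n y →
                     TypeAdj n x y ⇔ TypeAdj m (relabel (to ∘ I) x) (relabel (to ∘ I) y)
  relabel-TypeAdj⇔ {x} {y} okx oky =
    distinct⇔ ×-⇔ mk⇔ (λ h i → Equivalence.to (pointwise i) (h i))
                      (λ h i → Equivalence.from (pointwise i) (h i))
    where
    distinct⇔ : x ≢ y ⇔ relabel (to ∘ I) x ≢ relabel (to ∘ I) y
    distinct⇔ = mk⇔
      (λ x≢y Ix≡Iy → x≢y (trans (sym (relabel-inverse x okx))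
                                (trans (cong (relabel (from ∘ I)) Ix≡Iy) (relabel-inverse y oky))))
      (λ Ix≢Iy x≡y → Ix≢Iy (cong (relabel (to ∘ I)) x≡y))
    pointwise : ∀ i → lookup n i ∣ lookup x i * lookup y i
                    ⇔ lookup m i ∣ lookup (relabel (to ∘ I) x) i * lookup (relabel (to ∘ I) y) i
    pointwise i = ∣-≡⇔ (sym (cong₂ _*_ (lookup-relabel (to ∘ I) x i) (lookup-relabel (to ∘ I) y i)))
                  ⇔-∘ labelMap-∣*⇔ (I i) (m≢0 i) (okx i) (oky i)

divisorIsos⇒TypeGraphIso : {k : ℕ} {n m : Vec ℕ k} →
                           (I : (i : Fin k) → DivisorIso (lookup n i) (lookup m i)) →
                           ((i : Fin k) → lookup n i ≢ 0) → ((i : Fin k) → lookup m i ≢ 0) →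
                           TypeGraphIso n m
divisorIsos⇒TypeGraphIso {n = n} {m} I n≢0 m≢0 = record
  { to      = relabelVertex
  ; from    = Backward.relabelVertex
  ; from∘to = λ { (x , ok , _) → relabel-inverse x ok }
  ; to∘from = λ { (y , ok , _) → Backward.relabel-inverse y ok }
  ; adj⇔    = λ { (_ , okx , _) (_ , oky , _) →
                  let adj⇔ = relabel-TypeAdj⇔ okx oky
                  in Equivalence.to adj⇔ , Equivalence.from adj⇔ } }
  where
  open Relabelling {n = n} {m} I m≢0
  module Backward = Relabelling {n = m} {n} (DivisorIso-sym ∘ I) n≢0

theorem1p10 : (k : ℕ) (n m : Vec ℕ k) →
    ((i : Fin k) → 2 ≤ lookup n i) → ((i : Fin k) → 2 ≤ lookup m i) →
    ((i : Fin k) → SameExponentShape (lookup n i) (lookup m i)) →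
    TypeGraphIso n m
theorem1p10 k n m 2≤n 2≤m shape =
  divisorIsos⇒TypeGraphIso (sameExponentShape⇒DivisorIso ∘ shape)
                           (m<n⇒n≢0 ∘ 2≤n) (m<n⇒n≢0 ∘ 2≤m)
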